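{- For every permutation $\pi$ and every prefix transreversal $\beta\tau$ applicable to $\pi$, $b(\pi)-b(\pi\cdot\beta\tau)\le 2$.
   Context: A permutation is $\pi=[\pi_0,\pi_1,\ldots,\pi_n,\pi_{n+1}]$ with $\pi_0=0$, $\pi_{n+1}=n+1$ and $(\pi_1,\ldots,\pi_n)$ a permutation of $\{1,\ldots,n\}$. A prefix transreversal $\beta\tau=\beta\tau(1,j,k)$, for $2\le j\le n$ and $j<k\le n+1$, transforms $\pi$ into $\pi\cdot\beta\tau=[\pi_0,\pi_j,\ldots,\pi_{k-1},\pi_{j-1},\ldots,\pi_1,\pi_k,\ldots,\pi_{n+1}]$. Breakpoints: position $1$ is always a breakpoint; for $2\le i\le n+1$, position $i$ is a breakpoint iff $|\pi_i-\pi_{i-1}|\neq 1$. $b(\pi)$ is the number of breakpoints. -}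

module Defs where

open import Data.Nat using (ℕ; zero; suc; _+_; _∸_; _≤_; _<_; _<ᵇ_; _≡ᵇ_; pred)
open import Data.Nat.Base using (∣_-_∣)
open import Data.Bool using (Bool; true; false; if_then_else_; not; _∨_)
open import Data.Fin using (Fin; toℕ)
open import Data.Fin.Permutation using (Permutation′; _⟨$⟩ʳ_)
open import Data.Fin.Properties using ()
open import Data.Nat.Properties using (_<?_)
open import Relation.Nullary.Decidable using (Dec; yes; no)

-- A permutation π = [π_0, π_1, …, π_n, π_{n+1}] is represented by a
-- permutation σ of Fin n with π_i = 1 + toℕ (σ (i-1)) for 1 ≤ i ≤ n,
-- and π_0 = 0, π_{n+1} = n+1.  Its extended sequence is a function ℕ → ℕ
-- (positions beyond n+1 are irrelevant and are set to n+1).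

Seq : Set
Seq = ℕ → ℕ

ext : (n : ℕ) → Permutation′ n → Seq
ext n σ zero = 0
ext n σ (suc i) with i <? n
... | yes i<n = suc (toℕ (σ ⟨$⟩ʳ Data.Fin.fromℕ< i<n))
... | no _    = suc n

-- Prefix transreversal βτ(1,j,k) acting on a sequence:
--   result = [π_0, π_j, …, π_{k-1}, π_{j-1}, …, π_1, π_k, …, π_{n+1}]
-- i.e. position p ↦
--   p = 0            : π_0
--   1 ≤ p ≤ k-j      : π_{j+p-1}
--   k-j < p < k      : π_{k-p}
--   p ≥ k            : π_p
transrev : (j k : ℕ) → Seq → Seq
transrev j k s zero = s zero
transrev j k s (suc q) =
  if suc q <ᵇ k
  then (if q <ᵇ (k ∸ j) then s (j + q) else s (k ∸ suc q))
  else s (suc q)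

isBreak : Seq → ℕ → Bool
isBreak s (suc zero) = true
isBreak s i = not (∣ s i - s (pred i) ∣ ≡ᵇ 1)

countBreaks : Seq → ℕ → ℕ
countBreaks s zero = 0
countBreaks s (suc m) = countBreaks s m + (if isBreak s (suc m) then 1 else 0)

b : (n : ℕ) → Seq → ℕ
b n s = countBreaks s (suc n)

-- Cut the sequence at the positions 1, j and k of the transreversal.  Between
-- consecutive cuts the transreversal only moves a block, rigidly (π_j … π_{k-1})
-- or reversed (π_1 … π_{j-1}), and a reversed block has the same adjacent
-- differences up to sign.  Hence every breakpoint of π away from the cuts j and k
-- reappears in π · βτ, which gives b(π) ≤ b(π · βτ) + 2.  Nothing about π
-- beyond being a sequence is used.
module Submission where

open import Defs
open import Data.Nat using (ℕ; zero; suc; _+_; _∸_; _≤_; _<_; _<ᵇ_; z≤n; s≤s; z<s)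
open import Data.Nat.Properties
open import Data.Nat.Tactic.RingSolver using (solve-∀)
open import Data.Bool using (true; false; if_then_else_)
open import Data.Product using (_,_)
open import Data.Fin.Permutation using (Permutation′)
open import Relation.Nullary.Negation using (contradiction)
open import Relation.Nullary.Reflects using (ofʸ; ofⁿ)
open import Relation.Binary.PropositionalEquality

breakAt : Seq → ℕ → ℕ
breakAt s i = if isBreak s i then 1 else 0

breakAt≤1 : ∀ s i → breakAt s i ≤ 1
breakAt≤1 s i with isBreak s i
... | true  = ≤-refl
... | false = z≤n

breakAt-local : ∀ {s t} p → s p ≡ t p → s (suc p) ≡ t (suc p) →
  breakAt s (suc p) ≡ breakAt t (suc p)
breakAt-local zero    _  _  = refl
breakAt-local (suc p) e₀ e₁ rewrite e₀ | e₁ = refl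

breakAt-cong : ∀ {s t} m n → s (suc m) ≡ t (suc n) → s (suc (suc m)) ≡ t (suc (suc n)) →
  breakAt s (suc (suc m)) ≡ breakAt t (suc (suc n))
breakAt-cong m n e₀ e₁ rewrite e₀ | e₁ = refl

breakAt-swap : ∀ {s t} m n → s (suc m) ≡ t (suc (suc n)) → s (suc (suc m)) ≡ t (suc n) →
  breakAt s (suc (suc m)) ≡ breakAt t (suc (suc n))
breakAt-swap {t = t} m n e₀ e₁ rewrite e₀ | e₁ | ∣-∣-comm (t (suc n)) (t (suc (suc n))) = refl

sumFrom : (ℕ → ℕ) → ℕ → ℕ → ℕ
sumFrom f x zero    = 0
sumFrom f x (suc m) = sumFrom f x m + f (suc (x + m))

sumFrom-suc : ∀ f x m → sumFrom f x (suc m) ≡ f (suc x) + sumFrom f (suc x) m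
sumFrom-suc f x zero    = trans (cong f (cong suc (+-identityʳ x))) (sym (+-identityʳ _))
sumFrom-suc f x (suc m) = begin
  sumFrom f x (suc m) + f (suc (x + suc m))             ≡⟨ cong₂ _+_ (sumFrom-suc f x m) (cong f (cong suc (+-suc x m))) ⟩
  f (suc x) + sumFrom f (suc x) m + f (suc (suc x + m)) ≡⟨ +-assoc (f (suc x)) _ _ ⟩
  f (suc x) + sumFrom f (suc x) (suc m)                 ∎
  where open ≡-Reasoning

sumFrom-cong : ∀ f g x y m → (∀ i → i < m → f (suc (x + i)) ≡ g (suc (y + i))) →
  sumFrom f x m ≡ sumFrom g y m
sumFrom-cong f g x y zero    _ = refl
sumFrom-cong f g x y (suc m) h =
  cong₂ _+_ (sumFrom-cong f g x y m (λ i i<m → h i (m<n⇒m<1+n i<m))) (h m ≤-refl)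

sumFrom-reverse : ∀ f g x y m → (∀ i r → i + suc r ≡ m → f (suc (x + i)) ≡ g (suc (y + r))) →
  sumFrom f x m ≡ sumFrom g y m
sumFrom-reverse f g x y zero    _ = refl
sumFrom-reverse f g x y (suc m) h = begin
  sumFrom f x m + f (suc (x + m))         ≡⟨ cong₂ _+_ (sumFrom-reverse f g x (suc y) m h′) (h m 0 (+-comm m 1)) ⟩
  sumFrom g (suc y) m + g (suc (y + 0))   ≡⟨ +-comm _ (g (suc (y + 0))) ⟩
  g (suc (y + 0)) + sumFrom g (suc y) m   ≡⟨ cong (λ z → g (suc z) + sumFrom g (suc y) m) (+-identityʳ y) ⟩
  g (suc y) + sumFrom g (suc y) m         ≡⟨ sym (sumFrom-suc g y m) ⟩
  sumFrom g y (suc m)                     ∎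
  where
  open ≡-Reasoning
  h′ : ∀ i r → i + suc r ≡ m → f (suc (x + i)) ≡ g (suc (suc y + r))
  h′ i r e = trans (h i (suc r) (trans (+-suc i (suc r)) (cong suc e))) (cong (λ z → g (suc z)) (+-suc y r))

sumFrom-breakAt-cong : ∀ {s t} x m → (∀ q → x ≤ q → s q ≡ t q) →
  sumFrom (breakAt s) x m ≡ sumFrom (breakAt t) x m
sumFrom-breakAt-cong x m h = sumFrom-cong _ _ x x m λ i _ →
  breakAt-local (x + i) (h _ (m≤m+n x i)) (h _ (m≤n⇒m≤1+n (m≤m+n x i)))

countBreaks-+ : ∀ s x m → countBreaks s (x + m) ≡ countBreaks s x + sumFrom (breakAt s) x m
countBreaks-+ s x zero    = trans (cong (countBreaks s) (+-identityʳ x)) (sym (+-identityʳ _))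
countBreaks-+ s x (suc m) = begin
  countBreaks s (x + suc m)                                           ≡⟨ cong (countBreaks s) (+-suc x m) ⟩
  countBreaks s (x + m) + breakAt s (suc (x + m))                     ≡⟨ cong (_+ breakAt s (suc (x + m))) (countBreaks-+ s x m) ⟩
  countBreaks s x + sumFrom (breakAt s) x m + breakAt s (suc (x + m)) ≡⟨ +-assoc (countBreaks s x) _ _ ⟩
  countBreaks s x + sumFrom (breakAt s) x (suc m)                     ∎
  where open ≡-Reasoning

countBreaks-segments : ∀ s p q e → let j = suc (suc p) ; k = suc j + q in
  countBreaks s (k + e) ≡
    1 + sumFrom (breakAt s) 1 p + breakAt s j + sumFrom (breakAt s) j q + breakAt s k + sumFrom (breakAt s) k e
countBreaks-segments s p q e = begin
  countBreaks s (k + e)                                                  ≡⟨ countBreaks-+ s k e ⟩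
  countBreaks s (j + q) + breakAt s k + Bs k e                           ≡⟨ cong (λ z → z + breakAt s k + Bs k e) (countBreaks-+ s j q) ⟩
  countBreaks s (suc p) + breakAt s j + Bs j q + breakAt s k + Bs k e    ≡⟨ cong (λ z → z + breakAt s j + Bs j q + breakAt s k + Bs k e) (countBreaks-+ s 1 p) ⟩
  1 + Bs 1 p + breakAt s j + Bs j q + breakAt s k + Bs k e               ∎
  where
  open ≡-Reasoning
  j = suc (suc p)
  k = suc j + q
  Bs = sumFrom (breakAt s)

transrev-≥ : ∀ j k s q → k ≤ q → transrev j k s q ≡ s q
transrev-≥ j k s zero    _   = refl
transrev-≥ j k s (suc q) k≤q with suc q <ᵇ k | <ᵇ-reflects-< (suc q) k
... | false | _        = refl
... | true  | ofʸ q<k  = contradiction q<k (≤⇒≯ k≤q)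

transrev-moved : ∀ j k s q → suc q < k → q < k ∸ j → transrev j k s (suc q) ≡ s (j + q)
transrev-moved j k s q q<k q<k∸j
  with suc q <ᵇ k | <ᵇ-reflects-< (suc q) k | q <ᵇ k ∸ j | <ᵇ-reflects-< q (k ∸ j)
... | true  | _        | true  | _         = refl
... | false | ofⁿ q≮k  | _     | _         = contradiction q<k q≮k
... | true  | _        | false | ofⁿ q≮k∸j = contradiction q<k∸j q≮k∸j

transrev-reversed : ∀ j k s q i → k ≡ suc q + suc i → k ∸ j ≤ q →
  transrev j k s (suc q) ≡ s (suc i)
transrev-reversed j k s q i k≡ k∸j≤q
  with suc q <ᵇ k | <ᵇ-reflects-< (suc q) k | q <ᵇ k ∸ j | <ᵇ-reflects-< q (k ∸ j)
... | true  | _        | false | _         = cong s (trans (cong (_∸ suc q) k≡) (m+n∸m≡n (suc q) (suc i)))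
... | false | ofⁿ q≮k  | _     | _         = contradiction (subst (suc q <_) (sym k≡) (m<m+n (suc q) z<s)) q≮k
... | true  | _        | true  | ofʸ q<k∸j = contradiction q<k∸j (≤⇒≯ k∸j≤q)

module _ (s : Seq) (a d : ℕ) where
  private
    j = suc (suc a)
    k = suc j + d
    t = transrev j k s

    k∸j≡ : k ∸ j ≡ suc d
    k∸j≡ = trans (cong (_∸ a) (sym (+-suc a d))) (m+n∸m≡n a (suc d))

    moved : ∀ q → q ≤ d → t (suc q) ≡ s (j + q)
    moved q q≤d = transrev-moved j k s q
      (s≤s (s≤s (≤-trans q≤d (≤-trans (n≤1+n d) (s≤s (m≤n+m d a))))))
      (subst (q <_) (sym k∸j≡) (s≤s q≤d))

  transrev-moved-breaks : ∀ i → i < d → breakAt s (suc (j + i)) ≡ breakAt t (suc (1 + i))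
  transrev-moved-breaks i i<d = breakAt-cong {s} {t} (suc (a + i)) i
    (sym (moved i (<⇒≤ i<d)))
    (sym (trans (moved (suc i) i<d) (cong s (+-suc j i))))

  transrev-reversed-breaks : ∀ i r → i + suc r ≡ a →
    breakAt s (suc (1 + i)) ≡ breakAt t (suc (suc (suc d) + r))
  transrev-reversed-breaks i r i+1+r≡a = breakAt-swap {s} {t} i (suc (d + r))
    (sym (transrev-reversed j k s (suc (suc (d + r))) i k≡ (m≤n⇒m≤1+n k∸j≤)))
    (sym (transrev-reversed j k s (suc (d + r)) (suc i) (trans k≡ (sym (+-suc (suc (suc (d + r))) (suc i)))) k∸j≤))
    where
    shuffle : ∀ i r d → suc (suc (suc (i + suc r))) + d ≡ suc (suc (suc (d + r))) + suc i
    shuffle = solve-∀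
    k≡ : k ≡ suc (suc (suc (d + r))) + suc i
    k≡ = trans (cong (λ x → suc (suc (suc x)) + d) (sym i+1+r≡a)) (shuffle i r d)
    k∸j≤ : k ∸ j ≤ suc (d + r)
    k∸j≤ = subst (_≤ suc (d + r)) (sym k∸j≡) (s≤s (m≤m+n d r))

+-swap-blocks-≤ : ∀ X Y Z u v u′ v′ → u ≤ 1 → v ≤ 1 →
  1 + X + u + Y + v + Z ≤ 1 + Y + u′ + X + v′ + Z + 2
+-swap-blocks-≤ X Y Z u v u′ v′ u≤1 v≤1 = begin
  1 + X + u + Y + v + Z         ≤⟨ +-monoˡ-≤ Z (+-mono-≤ (+-monoˡ-≤ Y (+-monoʳ-≤ (1 + X) u≤1)) v≤1) ⟩
  1 + X + 1 + Y + 1 + Z         ≡⟨ rearrange X Y Z ⟩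
  1 + Y + 0 + X + 0 + Z + 2     ≤⟨ +-monoˡ-≤ 2 (+-monoˡ-≤ Z (+-mono-≤ (+-monoˡ-≤ X (+-monoʳ-≤ (1 + Y) z≤n)) z≤n)) ⟩
  1 + Y + u′ + X + v′ + Z + 2   ∎
  where
  open ≤-Reasoning
  rearrange : ∀ X Y Z → 1 + X + 1 + Y + 1 + Z ≡ 1 + Y + 0 + X + 0 + Z + 2
  rearrange = solve-∀

countBreaks-transrev : ∀ s a d e → let j = suc (suc a) ; k = suc j + d in
  countBreaks s (k + e) ≤ countBreaks (transrev j k s) (k + e) + 2
countBreaks-transrev s a d e = begin
  countBreaks s (k + e)                    ≡⟨ countBreaks-segments s a d e ⟩
  1 + X + u + Y + v + Z                    ≤⟨ +-swap-blocks-≤ X Y Z u v u′ v′ (breakAt≤1 s j) (breakAt≤1 s k) ⟩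
  1 + Y + u′ + X + v′ + Z + 2              ≡⟨ cong₂ (λ x y → 1 + x + u′ + y + v′ + Z + 2) Y≡ X≡ ⟩
  1 + Y′ + u′ + X′ + v′ + Z + 2            ≡⟨ cong (λ z → 1 + Y′ + u′ + X′ + v′ + z + 2) Z≡ ⟩
  1 + Y′ + u′ + X′ + v′ + Z′ + 2           ≡⟨ cong (_+ 2) (sym (countBreaks-segments t d a e)) ⟩
  countBreaks t (k′ + e) + 2               ≡⟨ cong (λ x → countBreaks t (x + e) + 2) k′≡k ⟩
  countBreaks t (k + e) + 2                ∎
  where
  open ≤-Reasoning
  j = suc (suc a)
  k = suc j + d
  t = transrev j k s
  j′ = suc (suc d)
  k′ = suc j′ + a
  k′≡k : k′ ≡ k
  k′≡k = cong (λ x → suc (suc (suc x))) (+-comm d a)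
  X = sumFrom (breakAt s) 1 a
  Y = sumFrom (breakAt s) j d
  Z = sumFrom (breakAt s) k e
  X′ = sumFrom (breakAt t) j′ a
  Y′ = sumFrom (breakAt t) 1 d
  Z′ = sumFrom (breakAt t) k′ e
  u = breakAt s j
  v = breakAt s k
  u′ = breakAt t j′
  v′ = breakAt t k′
  Y≡ : Y ≡ Y′
  Y≡ = sumFrom-cong _ _ j 1 d (transrev-moved-breaks s a d)
  X≡ : X ≡ X′
  X≡ = sumFrom-reverse _ _ 1 j′ a (transrev-reversed-breaks s a d)
  Z≡ : Z ≡ Z′
  Z≡ = trans (cong (λ x → sumFrom (breakAt s) x e) (sym k′≡k))
    (sumFrom-breakAt-cong k′ e λ q k′≤q → sym (transrev-≥ j k s q (subst (_≤ q) k′≡k k′≤q)))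

countBreaks-transrev-≤ : ∀ s j k N → 2 ≤ j → j < k → k ≤ N →
  countBreaks s N ≤ countBreaks (transrev j k s) N + 2
countBreaks-transrev-≤ s (suc (suc a)) k N (s≤s (s≤s z≤n)) j<k k≤N
  with m≤n⇒∃[o]m+o≡n j<k | m≤n⇒∃[o]m+o≡n k≤N
... | d , refl | e , refl = countBreaks-transrev s a d e

lemma6 : (n : ℕ) (σ : Permutation′ n) (j k : ℕ) →
    2 ≤ j → j ≤ n → j < k → k ≤ n + 1 →
    b n (ext n σ) ≤ b n (transrev j k (ext n σ)) + 2
lemma6 n σ j k 2≤j _ j<k k≤n+1 =
  countBreaks-transrev-≤ (ext n σ) j k (suc n) 2≤j j<k (subst (k ≤_) (+-comm n 1) k≤n+1)
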